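{- Let $d\geq 7$ and let $G$ be a $d$-regular graph with girth $5$. Suppose there exists a vertex $x$ of $G$ with neighbors $x_1,\dots,x_d$ and two distinct indices $i\neq j$ such that every neighbor of every vertex of $X_i\cup X_j$ lies in $N_2(x)$, where $X_t=N(x_t)\setminus\{x\}$. Then $\chi_b(G)=d+1$.
   Context: All graphs are simple, finite and undirected. $N_2(x)=N(x)\cup S_2(x)$, where $S_2(x)$ is the set of vertices at distance exactly $2$ from $x$. The set $X_t=N(x_t)\setminus\{x\}$ is called the $t$-th bunch of $x$. A proper $k$-coloring $c:V(G)\to\{1,\dots,k\}$ is a b-coloring if for every color $i$ there is a vertex $v$ with $c(v)=i$ such that all $k$ colors appear on the closed neighborhood $N[v]$. The b-chromatic number $\chi_b(G)$ is the largest $k$ for which $G$ has a b-coloring with $k$ colors. -}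

module Defs where

open import Data.Nat using (ℕ; suc; _≤_; _<_)
open import Data.Fin using (Fin; zero; suc; toℕ)
open import Data.Fin.Base using (inject₁; fromℕ)
open import Data.Bool using (Bool; true; false; if_then_else_)
open import Data.List using (List; map; allFin)
open import Data.Nat.ListAction using (sum)
open import Data.Product using (Σ; ∃; _×_; _,_)
open import Data.Sum using (_⊎_)
open import Relation.Binary.PropositionalEquality using (_≡_; _≢_)
open import Relation.Nullary using (¬_)
open import Function.Definitions using (Injective)

record Graph (n : ℕ) : Set where
  field
    adj    : Fin n → Fin n → Bool
    sym    : ∀ u v → adj u v ≡ adj v u
    irrefl : ∀ v → adj v v ≡ false

open Graph public

module _ {n : ℕ} (G : Graph n) where

  Adj : Fin n → Fin n → Set
  Adj u v = adj G u v ≡ true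

  degree : Fin n → ℕ
  degree v = sum (map (λ u → if adj G v u then 1 else 0) (allFin n))

  Regular : ℕ → Set
  Regular d = ∀ v → degree v ≡ d

  next : {m : ℕ} → Fin (suc m) → Fin (suc m)
  next {m} i = cyc m i
    where
      -- i ↦ i+1, last ↦ 0
      cyc : (m : ℕ) → Fin (suc m) → Fin (suc m)
      cyc ℕ.zero zero = zero
      cyc (suc m) zero = suc zero
      cyc (suc m) (suc i) with cyc m i
      ... | zero = zero
      ... | suc j = suc (suc j)

  HasCycle : ℕ → Set
  HasCycle ℕ.zero = Data.Empty.⊥
    where import Data.Empty
  HasCycle (suc m) =
    Σ (Fin (suc m) → Fin n) λ f → Injective _≡_ _≡_ f × (∀ i → Adj (f i) (f (next i)))

  Girth : ℕ → Set
  Girth g = HasCycle g × (∀ k → 3 ≤ k → k < g → ¬ HasCycle k)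

  InS₂ : Fin n → Fin n → Set
  InS₂ x v = v ≢ x × ¬ Adj x v × ∃ λ w → Adj x w × Adj w v

  InN₂ : Fin n → Fin n → Set
  InN₂ x v = Adj x v ⊎ InS₂ x v

  InBunch : Fin n → Fin n → Fin n → Set
  InBunch x xt y = Adj xt y × y ≢ x

  Proper : (k : ℕ) → (Fin n → Fin k) → Set
  Proper k c = ∀ u v → Adj u v → c u ≢ c v

  IsBColoring : (k : ℕ) → (Fin n → Fin k) → Set
  IsBColoring k c = Proper k c ×
    (∀ (i : Fin k) → ∃ λ v → c v ≡ i ×
       (∀ (j : Fin k) → ∃ λ u → (u ≡ v ⊎ Adj v u) × c u ≡ j))

  HasBColoring : ℕ → Set
  HasBColoring k = ∃ λ (c : Fin n → Fin k) → IsBColoring k c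

  BChromatic : ℕ → Set
  BChromatic k = HasBColoring k × (∀ k' → HasBColoring k' → k' ≤ k)

-- Write x_i, x_j for the two special neighbours of x and x_q for the d − 2 others.
-- Girth 5 and the hypothesis that the neighbours of X_i ∪ X_j stay in N₂(x) give, by
-- counting neighbourhoods of size d, that every vertex of X_i ∪ X_j has a neighbour in
-- every other bunch and every vertex of another bunch has a neighbour in X_j.  So we can fix
-- u ∈ X_i, v ∈ X_j ∩ N(u), z_q ∈ X_q ∩ N(u) and b_q ∈ X_j ∩ N(z_q).  Precolour
--   colour 0: x_j;   colour 1: x_i, v and N(u) ∩ X_q;   colour 2: x and X_i;
--   colour 3+q: the x_q (cyclically shifted), X_j ∩ N(z_q) and X_q ∖ N(u).
-- Girth 5 makes this proper, x_j, v, x, b_q are b-vertices of colours 0, 1, 2, 3+q, and the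
-- precolouring extends greedily since every vertex has only d neighbours.  Conversely a
-- b-vertex sees all colours in its closed neighbourhood, so no b-colouring uses more than
-- d + 1 colours.

module Submission where

open import Defs hiding (sym)
open import Data.Nat as ℕ using (ℕ; suc; _≤_; _+_; s≤s)
open import Data.Nat.Properties using (1+n≰n; 1+n≢n; _<?_; _≤?_)
open import Data.Fin using (Fin; zero; suc; toℕ; fromℕ; inject₁; lower₁; punchIn; punchOut)
open import Data.Fin.Properties
  using (_≟_; any?; all?; ¬∀⟶∃¬; injective⇒≤; suc-injective; 0≢1+n; toℕ-injective; toℕ-fromℕ;
         toℕ-inject₁; inject₁-lower₁; punchIn-injective; punchInᵢ≢i; punchIn-punchOut)
open import Data.Bool as Bool using (Bool; true; if_then_else_)
open import Data.Bool.Properties using (¬-not)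
open import Data.List using (tabulate)
open import Data.List.Properties using (map-tabulate)
open import Data.Nat.ListAction using (sum)
open import Data.Maybe using (Maybe; just; nothing)
open import Data.Maybe.Properties as Maybe using (just-injective)
open import Data.Vec using (Vec; []; _∷_; lookup)
open import Data.Vec.Relation.Unary.All using ([]; _∷_)
open import Data.Vec.Relation.Unary.AllPairs using ([]; _∷_)
open import Data.Vec.Relation.Unary.Unique.Propositional using (Unique)
open import Data.Vec.Relation.Unary.Unique.Propositional.Properties using (lookup-injective)
import Data.Vec.Functional as Vector
open import Data.Vec.Functional.Properties using (updateAt-updates; updateAt-minimal)
open import Data.Product using (Σ; ∃; _×_; _,_; proj₁; proj₂)
open import Data.Sum using (_⊎_; inj₁; inj₂)
open import Data.Empty using (⊥; ⊥-elim)
open import Function using (_∘_; const)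
open import Function.Definitions using (Injective)
open import Relation.Nullary using (¬_; Dec; yes; no)
open import Relation.Nullary.Decidable using (_×-dec_; ¬?; decidable-stable; from-yes)
open import Relation.Unary using (Decidable)
open import Relation.Binary.PropositionalEquality
  using (_≡_; _≢_; refl; sym; trans; cong; subst)

fresh-∷-injective : ∀ {m n} {a : Fin n} {f : Fin m → Fin n} →
  (∀ i → f i ≢ a) → Injective _≡_ _≡_ f → Injective _≡_ _≡_ (a Vector.∷ f)
fresh-∷-injective fresh f-injective {zero} {zero} eq = refl
fresh-∷-injective fresh f-injective {zero} {suc j} eq = ⊥-elim (fresh j (sym eq))
fresh-∷-injective fresh f-injective {suc i} {zero} eq = ⊥-elim (fresh i eq)
fresh-∷-injective fresh f-injective {suc i} {suc j} eq = cong suc (f-injective eq)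

module _ {m : ℕ} (h : Fin m → Maybe (Fin (suc m))) where
  private
    hits? : ∀ i a → Dec (h i ≡ just a)
    hits? i a = Maybe.≡-dec _≟_ (h i) (just a)

  missing-value : ∃ λ a → ∀ i → h i ≢ just a
  missing-value with any? (λ a → all? (λ i → ¬? (hits? i a)))
  ... | yes (a , missed) = a , missed
  ... | no all-hit = ⊥-elim (1+n≰n (injective⇒≤ {f = proj₁ ∘ hit} hit-injective))
    where
      hit : ∀ a → ∃ λ i → h i ≡ just a
      hit a with ¬∀⟶∃¬ m _ (λ i → ¬? (hits? i a)) (λ missed → all-hit (a , missed))
      ... | i , ¬¬hit = i , decidable-stable (hits? i a) ¬¬hit
      hit-injective : Injective _≡_ _≡_ (proj₁ ∘ hit)
      hit-injective {a} {b} eq =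
        just-injective (trans (sym (proj₂ (hit a))) (trans (cong h eq) (proj₂ (hit b))))

rotate : ∀ {m} → Fin (suc m) → Fin (suc m)
rotate {m} zero = fromℕ m
rotate (suc i) = inject₁ i

rotate-fixpoint-free : ∀ {m} (i : Fin (suc (suc m))) → rotate i ≢ i
rotate-fixpoint-free zero ()
rotate-fixpoint-free (suc i) eq = 1+n≢n (trans (sym (cong toℕ eq)) (toℕ-inject₁ i))

rotate-surjective : ∀ {m} (j : Fin (suc m)) → ∃ λ i → rotate i ≡ j
rotate-surjective {m} j with m ℕ.≟ toℕ j
... | yes m≡j = zero , toℕ-injective (trans (toℕ-fromℕ m) m≡j)
... | no m≢j = suc (lower₁ j m≢j) , inject₁-lower₁ j m≢j

record Enumeration {n : ℕ} (P : Fin n → Set) (k : ℕ) : Set where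
  field
    element           : Fin k → Fin n
    element-injective : Injective _≡_ _≡_ element
    element-∈         : ∀ i → P (element i)
    index             : ∀ {w} → P w → Fin k
    element-index     : ∀ {w} (p : P w) → element (index p) ≡ w

  injection⇒≤ : ∀ {m} (f : Fin m → Fin n) → Injective _≡_ _≡_ f → (∀ i → P (f i)) → m ≤ k
  injection⇒≤ f f-injective f-∈ = injective⇒≤ {f = λ i → index (f-∈ i)} λ {i} {j} eq →
    f-injective (trans (sym (element-index (f-∈ i)))
                       (trans (cong element eq) (element-index (f-∈ j))))

module _ {n k : ℕ} {P : Fin (suc n) → Set} (E : Enumeration (P ∘ suc) k) where
  private module E = Enumeration E

  enumeration-skip : ¬ P zero → Enumeration P k
  enumeration-skip ¬P0 = record
    { element = suc ∘ E.element
    ; element-injective = λ eq → E.element-injective (suc-injective eq)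
    ; element-∈ = E.element-∈
    ; index = index
    ; element-index = element-index
    }
    where
      index : ∀ {w} → P w → Fin k
      index {zero} p = ⊥-elim (¬P0 p)
      index {suc w} p = E.index p
      element-index : ∀ {w} (p : P w) → suc (E.element (index p)) ≡ w
      element-index {zero} p = ⊥-elim (¬P0 p)
      element-index {suc w} p = cong suc (E.element-index p)

  enumeration-cons : P zero → Enumeration P (suc k)
  enumeration-cons P0 = record
    { element = zero Vector.∷ (suc ∘ E.element)
    ; element-injective =
        fresh-∷-injective (λ _ ()) (λ eq → E.element-injective (suc-injective eq))
    ; element-∈ = λ { zero → P0 ; (suc i) → E.element-∈ i }
    ; index = index
    ; element-index = element-index
    }
    where
      index : ∀ {w} → P w → Fin (suc k)
      index {zero} _ = zero
      index {suc w} p = suc (E.index p)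
      element-index : ∀ {w} (p : P w) → (zero Vector.∷ (suc ∘ E.element)) (index p) ≡ w
      element-index {zero} _ = refl
      element-index {suc w} p = cong suc (E.element-index p)

count : ∀ {n} {P : Fin n → Set} → Decidable P → ℕ
count {ℕ.zero} P? = 0
count {suc n} P? with P? zero
... | yes _ = suc (count (P? ∘ suc))
... | no _ = count (P? ∘ suc)

enumerate : ∀ {n} {P : Fin n → Set} (P? : Decidable P) → Enumeration P (count P?)
enumerate {ℕ.zero} P? = record
  { element = λ () ; element-injective = λ { {()} } ; element-∈ = λ ()
  ; index = λ { {()} } ; element-index = λ { {()} } }
enumerate {suc n} P? with P? zero
... | yes P0 = enumeration-cons (enumerate (P? ∘ suc)) P0
... | no ¬P0 = enumeration-skip (enumerate (P? ∘ suc)) ¬P0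

enumeration-∷ : ∀ {n k} {P : Fin n → Set} {a} → ¬ P a → Enumeration P k →
  Enumeration (λ w → w ≡ a ⊎ P w) (suc k)
enumeration-∷ {P = P} {a} ¬Pa E = record
  { element = a Vector.∷ E.element
  ; element-injective =
      fresh-∷-injective (λ i eq → ¬Pa (subst P eq (E.element-∈ i))) E.element-injective
  ; element-∈ = λ { zero → inj₁ refl ; (suc i) → inj₂ (E.element-∈ i) }
  ; index = λ { (inj₁ _) → zero ; (inj₂ p) → suc (E.index p) }
  ; element-index = λ { (inj₁ eq) → sym eq ; (inj₂ p) → E.element-index p }
  }
  where module E = Enumeration E

relabel : ∀ {n m} {P : Fin n → Set} {a b} → Enumeration P (suc (suc m)) → P a → P b → a ≢ b →
  Σ (Fin (suc (suc m)) → Fin n) λ f →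
    Injective _≡_ _≡_ f × (∀ i → P (f i)) × f zero ≡ a × f (suc zero) ≡ b
relabel {m = m} {a = a} {b} E Pa Pb a≢b =
  E.element ∘ σ , (λ eq → σ-injective (E.element-injective eq)) , E.element-∈ ∘ σ ,
  E.element-index Pa , trans (cong E.element (punchIn-punchOut ia≢ib)) (E.element-index Pb)
  where
    module E = Enumeration E
    ia ib : Fin (suc (suc m))
    ia = E.index Pa
    ib = E.index Pb
    ia≢ib : ia ≢ ib
    ia≢ib eq =
      a≢b (trans (sym (E.element-index Pa)) (trans (cong E.element eq) (E.element-index Pb)))
    jb : Fin (suc m)
    jb = punchOut ia≢ib
    σ : Fin (suc (suc m)) → Fin (suc (suc m))
    σ = ia Vector.∷ (punchIn ia ∘ (jb Vector.∷ punchIn jb))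
    σ-injective : Injective _≡_ _≡_ σ
    σ-injective = fresh-∷-injective (λ _ → punchInᵢ≢i ia _) λ eq →
      fresh-∷-injective (punchInᵢ≢i jb) (punchIn-injective jb _ _) (punchIn-injective ia _ _ eq)

sum-indicator≡count : ∀ {n} (f : Fin n → Bool) →
  sum (tabulate (λ w → if f w then 1 else 0)) ≡ count (λ w → f w Bool.≟ true)
sum-indicator≡count {ℕ.zero} f = refl
sum-indicator≡count {suc n} f with f zero Bool.≟ true
... | yes f0≡true rewrite f0≡true = cong suc (sum-indicator≡count (f ∘ suc))
... | no f0≢true rewrite ¬-not f0≢true = sum-indicator≡count (f ∘ suc)

module Adjacency {n : ℕ} (G : Graph n) where

  Adj? : ∀ v → Decidable (Adj G v)
  Adj? v w = adj G v w Bool.≟ true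

  adj-sym : ∀ {u w} → Adj G u w → Adj G w u
  adj-sym {u} {w} uw = trans (Graph.sym G w u) uw

  adj-irrefl : ∀ {u} → ¬ Adj G u u
  adj-irrefl {u} uu with () ← trans (sym uu) (irrefl G u)

  adj⇒≢ : ∀ {u w} → Adj G u w → u ≢ w
  adj⇒≢ uw refl = adj-irrefl uw

  _∈N[_] : Fin n → Fin n → Set
  w ∈N[ v ] = w ≡ v ⊎ Adj G v w

  degree≡count : ∀ v → degree G v ≡ count (Adj? v)
  degree≡count v =
    trans (cong sum (map-tabulate (λ w → w) (λ w → if adj G v w then 1 else 0)))
          (sum-indicator≡count (adj G v))

  neighbours : ∀ {d} → Regular G d → ∀ v → Enumeration (Adj G v) d
  neighbours regular v =
    subst (Enumeration (Adj G v)) (trans (sym (degree≡count v)) (regular v)) (enumerate (Adj? v))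

  GirthAtLeast : ℕ → Set
  GirthAtLeast g = ∀ k → 3 ≤ k → k ℕ.< g → ¬ HasCycle G k

  BunchNeighboursInN₂ : Fin n → Fin n → Set
  BunchNeighboursInN₂ x t = ∀ y → InBunch G x t y → ∀ z → Adj G y z → InN₂ G x z

  root-of : ∀ {x z} → InN₂ G x z → ∃ λ r → Adj G x r × z ∈N[ r ]
  root-of (inj₁ xz) = _ , xz , inj₁ refl
  root-of (inj₂ (_ , _ , r , xr , rz)) = r , xr , inj₂ rz

  module GirthAtLeast5 (girth≥5 : GirthAtLeast 5) where

    no-triangle : ∀ {a b c} → Adj G a b → Adj G b c → Adj G c a → ⊥
    no-triangle {a} {b} {c} ab bc ca =
      girth≥5 3 (from-yes (3 ≤? 3)) (from-yes (3 <? 5))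
        (lookup vs , (λ {i} {j} → lookup-injective distinct i j) , edges)
      where
        vs : Vec (Fin n) 3
        vs = a ∷ b ∷ c ∷ []
        distinct : Unique vs
        distinct = (adj⇒≢ ab ∷ adj⇒≢ ca ∘ sym ∷ []) ∷ (adj⇒≢ bc ∷ []) ∷ [] ∷ []
        edges : ∀ i → Adj G (lookup vs i) (lookup vs (next G i))
        edges zero = ab
        edges (suc zero) = bc
        edges (suc (suc zero)) = ca

    no-square : ∀ {a b c e} → Adj G a b → Adj G b c → Adj G c e → Adj G e a →
      a ≢ c → b ≢ e → ⊥
    no-square {a} {b} {c} {e} ab bc ce ea a≢c b≢e =
      girth≥5 4 (from-yes (3 ≤? 4)) (from-yes (4 <? 5))
        (lookup vs , (λ {i} {j} → lookup-injective distinct i j) , edges)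
      where
        vs : Vec (Fin n) 4
        vs = a ∷ b ∷ c ∷ e ∷ []
        distinct : Unique vs
        distinct = (adj⇒≢ ab ∷ a≢c ∷ adj⇒≢ ea ∘ sym ∷ [])
                 ∷ (adj⇒≢ bc ∷ b≢e ∷ []) ∷ (adj⇒≢ ce ∷ []) ∷ [] ∷ []
        edges : ∀ i → Adj G (lookup vs i) (lookup vs (next G i))
        edges zero = ab
        edges (suc zero) = bc
        edges (suc (suc zero)) = ce
        edges (suc (suc (suc zero))) = ea

    common-neighbour-unique : ∀ {a b b' c} → a ≢ c →
      Adj G a b → Adj G b c → Adj G a b' → Adj G b' c → b ≡ b'
    common-neighbour-unique a≢c ab bc ab' b'c =
      decidable-stable (_ ≟ _) (no-square ab bc (adj-sym b'c) (adj-sym ab') a≢c)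

module RegularGraph {n d : ℕ} (G : Graph n) (regular : Regular G d) where
  open Adjacency G

  ProperPartial : (Fin n → Maybe (Fin (suc d))) → Set
  ProperPartial pc = ∀ {w w' a} → Adj G w w' → pc w ≡ just a → pc w' ≡ just a → ⊥

  _⊑_ : (pc pc' : Fin n → Maybe (Fin (suc d))) → Set
  pc ⊑ pc' = ∀ {w a} → pc w ≡ just a → pc' w ≡ just a

  Coloured : (Fin n → Maybe (Fin (suc d))) → Fin n → Set
  Coloured pc w = ∃ λ a → pc w ≡ just a

  free-colour : ∀ pc w → ∃ λ a → ∀ {u} → Adj G w u → pc u ≢ just a
  free-colour pc w =
    proj₁ missing , λ wu eq → proj₂ missing (N.index wu) (trans (cong pc (N.element-index wu)) eq)
    where
      module N = Enumeration (neighbours regular w)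
      missing : ∃ λ a → ∀ i → pc (N.element i) ≢ just a
      missing = missing-value (pc ∘ N.element)

  colour-vertex : ∀ pc → ProperPartial pc → ∀ w →
    ∃ λ pc' → ProperPartial pc' × pc ⊑ pc' × Coloured pc' w
  colour-vertex pc proper w with pc w in pc-w
  ... | just a = pc , proper , (λ e → e) , a , pc-w
  ... | nothing = pc' , proper' , extends , a , updateAt-updates w pc
    where
      a : Fin (suc d)
      a = proj₁ (free-colour pc w)
      free : ∀ {u} → Adj G w u → pc u ≢ just a
      free = proj₂ (free-colour pc w)
      pc' : Fin n → Maybe (Fin (suc d))
      pc' = Vector.updateAt pc w (const (just a))
      at-w : ∀ {b} → pc' w ≡ just b → a ≡ b
      at-w e = just-injective (trans (sym (updateAt-updates w pc)) e)
      elsewhere : ∀ {u} → u ≢ w → pc' u ≡ pc u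
      elsewhere {u} u≢w = updateAt-minimal u w pc u≢w
      unchanged : ∀ {u b} → u ≢ w → pc' u ≡ just b → pc u ≡ just b
      unchanged u≢w e = trans (sym (elsewhere u≢w)) e
      extends : pc ⊑ pc'
      extends {u} e with u ≟ w
      ... | yes refl with () ← trans (sym pc-w) e
      ... | no u≢w = trans (elsewhere u≢w) e
      proper' : ProperPartial pc'
      proper' {w₁} {w₂} w₁w₂ e₁ e₂ with w₁ ≟ w | w₂ ≟ w
      ... | yes refl | yes refl = adj-irrefl w₁w₂
      ... | yes refl | no w₂≢w =
        free w₁w₂ (subst (λ b → pc w₂ ≡ just b) (sym (at-w e₁)) (unchanged w₂≢w e₂))
      ... | no w₁≢w | yes refl =
        free (adj-sym w₁w₂) (subst (λ b → pc w₁ ≡ just b) (sym (at-w e₂)) (unchanged w₁≢w e₁))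
      ... | no w₁≢w | no w₂≢w = proper w₁w₂ (unchanged w₁≢w e₁) (unchanged w₂≢w e₂)

  colour-all : ∀ {m} (ws : Fin m → Fin n) pc → ProperPartial pc →
    ∃ λ pc' → ProperPartial pc' × pc ⊑ pc' × (∀ i → Coloured pc' (ws i))
  colour-all {ℕ.zero} ws pc proper = pc , proper , (λ e → e) , λ ()
  colour-all {suc m} ws pc proper with colour-all (ws ∘ suc) pc proper
  ... | pc₁ , proper₁ , pc⊑pc₁ , coloured₁ with colour-vertex pc₁ proper₁ (ws zero)
  ... | pc₂ , proper₂ , pc₁⊑pc₂ , coloured₂ =
    pc₂ , proper₂ , (λ e → pc₁⊑pc₂ (pc⊑pc₁ e)) ,
    λ { zero → coloured₂ ; (suc i) → proj₁ (coloured₁ i) , pc₁⊑pc₂ (proj₂ (coloured₁ i)) }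

  greedy-extension : ∀ pc → ProperPartial pc →
    ∃ λ c → Proper G (suc d) c × (∀ {w a} → pc w ≡ just a → c w ≡ a)
  greedy-extension pc proper with colour-all (λ w → w) pc proper
  ... | pc' , proper' , pc⊑pc' , coloured =
    c , c-proper , λ {w} e → just-injective (trans (sym (pc'-c w)) (pc⊑pc' e))
    where
      c : Fin n → Fin (suc d)
      c w = proj₁ (coloured w)
      pc'-c : ∀ w → pc' w ≡ just (c w)
      pc'-c w = proj₂ (coloured w)
      c-proper : Proper G (suc d) c
      c-proper w w' ww' eq =
        proper' ww' (pc'-c w) (subst (λ a → pc' w' ≡ just a) (sym eq) (pc'-c w'))

  b-colouring-bound : ∀ k → HasBColoring G k → k ≤ suc d
  b-colouring-bound ℕ.zero _ = ℕ.z≤n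
  b-colouring-bound (suc k) (c , _ , b-vertices) =
    N[v].injection⇒≤ (proj₁ ∘ witness) witness-injective (proj₁ ∘ proj₂ ∘ witness)
    where
      v : Fin n
      v = proj₁ (b-vertices zero)
      witness : ∀ j → ∃ λ w → w ∈N[ v ] × c w ≡ j
      witness = proj₂ (proj₂ (b-vertices zero))
      module N[v] = Enumeration (enumeration-∷ adj-irrefl (neighbours regular v))
      witness-injective : Injective _≡_ _≡_ (proj₁ ∘ witness)
      witness-injective {i} {j} eq =
        trans (sym (proj₂ (proj₂ (witness i)))) (trans (cong c eq) (proj₂ (proj₂ (witness j))))

  no-injection-into-neighbourhood : ∀ {y v a} (f : ∀ {z} → Adj G y z → Fin n) →
    (∀ {z} (yz : Adj G y z) → Adj G v (f yz)) →
    (∀ {z z'} (yz : Adj G y z) (yz' : Adj G y z') → f yz ≡ f yz' → z ≡ z') →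
    Adj G v a → (∀ {z} (yz : Adj G y z) → f yz ≢ a) → ⊥
  no-injection-into-neighbourhood {y} {v} {a} f f-adj f-injective va f≢a =
    1+n≰n (N[v].injection⇒≤ g g-injective g-adj)
    where
      module N[y] = Enumeration (neighbours regular y)
      module N[v] = Enumeration (neighbours regular v)
      g : Fin (suc d) → Fin n
      g = a Vector.∷ (λ i → f (N[y].element-∈ i))
      g-injective : Injective _≡_ _≡_ g
      g-injective = fresh-∷-injective (λ i → f≢a (N[y].element-∈ i))
                                      (λ eq → N[y].element-injective (f-injective _ _ eq))
      g-adj : ∀ i → Adj G v (g i)
      g-adj zero = va
      g-adj (suc i) = f-adj (N[y].element-∈ i)

module Bunches {n d : ℕ} (G : Graph n) (regular : Regular G d)
               (girth≥5 : Adjacency.GirthAtLeast G 5) where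
  open Adjacency G
  open GirthAtLeast5 girth≥5
  open RegularGraph G regular

  distinct-neighbours-distinct-roots : ∀ {x y z z' r} → ¬ Adj G x y →
    Adj G y z → Adj G y z' → z ≢ z' → Adj G x r → z ∈N[ r ] → z' ∈N[ r ] → ⊥
  distinct-neighbours-distinct-roots _ _ _ z≢z' _ (inj₁ refl) (inj₁ refl) = z≢z' refl
  distinct-neighbours-distinct-roots _ yz yz' _ _ (inj₁ refl) (inj₂ zz') = no-triangle yz zz' (adj-sym yz')
  distinct-neighbours-distinct-roots _ yz yz' _ _ (inj₂ z'z) (inj₁ refl) = no-triangle yz' z'z (adj-sym yz)
  distinct-neighbours-distinct-roots {x} ¬xy yz yz' z≢z' xr (inj₂ rz) (inj₂ rz') =
    ¬xy (subst (Adj G x) (common-neighbour-unique z≢z' (adj-sym rz) rz' (adj-sym yz) yz') xr)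

  bunch-meets-bunch : ∀ {x t s y} → Adj G x t → BunchNeighboursInN₂ x t → InBunch G x t y →
    Adj G x s → s ≢ t → ∃ λ w → Adj G y w × InBunch G x s w
  bunch-meets-bunch {x} {t} {s} {y} xt closed y∈Xₜ@(ty , y≢x) xs s≢t
    with any? (λ w → Adj? y w ×-dec Adj? s w)
  ... | yes (w , yw , sw) = w , yw , sw , λ { refl → no-triangle xt ty yw }
  ... | no no-common =
    -- Every neighbour of y has a root in N(x); the roots are distinct and avoid s.
    ⊥-elim (no-injection-into-neighbourhood root (proj₁ ∘ proj₂ ∘ rooted)
                                            roots-injective xs root≢s)
    where
      rooted : ∀ {z} → Adj G y z → ∃ λ r → Adj G x r × z ∈N[ r ]
      rooted yz = root-of (closed _ y∈Xₜ _ yz)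
      root : ∀ {z} → Adj G y z → Fin n
      root yz = proj₁ (rooted yz)
      roots-injective : ∀ {z z'} (yz : Adj G y z) (yz' : Adj G y z') → root yz ≡ root yz' → z ≡ z'
      roots-injective yz yz' eq = decidable-stable (_ ≟ _) λ z≢z' →
        distinct-neighbours-distinct-roots (λ xy → no-triangle xt ty (adj-sym xy)) yz yz' z≢z'
          (proj₁ (proj₂ (rooted yz))) (proj₂ (proj₂ (rooted yz)))
          (subst (λ r → _ ∈N[ r ]) (sym eq) (proj₂ (proj₂ (rooted yz'))))
      not-s : ∀ {z r} → Adj G y z → z ∈N[ r ] → r ≢ s
      not-s ys (inj₁ refl) refl = s≢t (common-neighbour-unique (y≢x ∘ sym) xs (adj-sym ys) xt ty)
      not-s yz (inj₂ sz) refl = no-common (_ , yz , sz)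
      root≢s : ∀ {z} (yz : Adj G y z) → root yz ≢ s
      root≢s yz = not-s yz (proj₂ (proj₂ (rooted yz)))

  closed-bunch-meets-bunch : ∀ {x t s w} → Adj G x t → BunchNeighboursInN₂ x t →
    Adj G x s → s ≢ t → InBunch G x s w → ∃ λ b → InBunch G x t b × Adj G w b
  closed-bunch-meets-bunch {x} {t} {s} {w} xt closed xs s≢t (sw , w≢x)
    with any? (λ b → Adj? t b ×-dec Adj? w b)
  ... | yes (b , tb , wb) = b , (tb , λ { refl → no-triangle xs sw wb }) , wb
  ... | no no-common =
    -- Matching x with x and each vertex of X_t with a neighbour in X_s injects N(t) into
    -- N(s) ∖ {w}.
    ⊥-elim (no-injection-into-neighbourhood partner (proj₁ ∘ proj₂ ∘ matched)
                                            partners-injective sw partner≢w)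
    where
      Matched : Fin n → Fin n → Set
      Matched s' σ = (s' ≡ x × σ ≡ x) ⊎ (Adj G s' σ × σ ≢ x)
      matched : ∀ {s'} → Adj G t s' → ∃ λ σ → Adj G s σ × Matched s' σ
      matched {s'} ts' with s' ≟ x
      ... | yes s'≡x = x , adj-sym xs , inj₁ (s'≡x , refl)
      ... | no s'≢x with bunch-meets-bunch xt closed (ts' , s'≢x) xs s≢t
      ...   | σ , s'σ , sσ , σ≢x = σ , sσ , inj₂ (s'σ , σ≢x)
      partner : ∀ {s'} → Adj G t s' → Fin n
      partner ts' = proj₁ (matched ts')
      distinct-matched : ∀ {s₁ s₂ σ} → s₁ ≢ s₂ → Adj G t s₁ → Adj G t s₂ → Adj G s σ →
        Matched s₁ σ → Matched s₂ σ → ⊥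
      distinct-matched s₁≢s₂ _ _ _ (inj₁ (refl , _)) (inj₁ (refl , _)) = s₁≢s₂ refl
      distinct-matched _ _ _ _ (inj₁ (_ , σ≡x)) (inj₂ (_ , σ≢x)) = σ≢x σ≡x
      distinct-matched _ _ _ _ (inj₂ (_ , σ≢x)) (inj₁ (_ , σ≡x)) = σ≢x σ≡x
      distinct-matched {σ = σ} s₁≢s₂ ts₁ ts₂ sσ (inj₂ (s₁σ , _)) (inj₂ (s₂σ , _)) =
        no-triangle xt (adj-sym (subst (Adj G s) σ≡t sσ)) (adj-sym xs)
        where
          σ≡t : σ ≡ t
          σ≡t = common-neighbour-unique s₁≢s₂ s₁σ (adj-sym s₂σ) (adj-sym ts₁) ts₂
      partners-injective : ∀ {s₁ s₂} (ts₁ : Adj G t s₁) (ts₂ : Adj G t s₂) →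
        partner ts₁ ≡ partner ts₂ → s₁ ≡ s₂
      partners-injective ts₁ ts₂ eq = decidable-stable (_ ≟ _) λ s₁≢s₂ →
        distinct-matched s₁≢s₂ ts₁ ts₂ (proj₁ (proj₂ (matched ts₁))) (proj₂ (proj₂ (matched ts₁)))
          (subst (Matched _) (sym eq) (proj₂ (proj₂ (matched ts₂))))
      not-w : ∀ {s' σ} → Adj G t s' → Matched s' σ → σ ≢ w
      not-w _ (inj₁ (_ , σ≡x)) σ≡w = w≢x (trans (sym σ≡w) σ≡x)
      not-w ts' (inj₂ (s'σ , _)) σ≡w = no-common (_ , ts' , adj-sym (subst (Adj G _) σ≡w s'σ))
      partner≢w : ∀ {s'} (ts' : Adj G t s') → partner ts' ≢ w
      partner≢w ts' = not-w ts' (proj₂ (proj₂ (matched ts')))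

bunch-nonempty : ∀ {n d} (G : Graph n) → Regular G (suc (suc d)) → ∀ x t → ∃ (InBunch G x t)
bunch-nonempty G regular x t = pick (N.element zero ≟ x)
  where
    module N = Enumeration (Adjacency.neighbours G regular t)
    pick : Dec (N.element zero ≡ x) → ∃ (InBunch G x t)
    pick (no e₀≢x) = N.element zero , N.element-∈ zero , e₀≢x
    pick (yes e₀≡x) = N.element (suc zero) , N.element-∈ (suc zero) , λ e₁≡x →
      0≢1+n (N.element-injective (trans e₀≡x (sym e₁≡x)))

module Construction {n k : ℕ} (G : Graph n) (regular : Regular G (4 + k))
  (girth≥5 : Adjacency.GirthAtLeast G 5) (x : Fin n)
  (nbr : Fin (4 + k) → Fin n) (nbr-injective : Injective _≡_ _≡_ nbr)
  (x-nbr : ∀ i → Adj G x (nbr i))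
  (closedᵢ : Adjacency.BunchNeighboursInN₂ G x (nbr zero))
  (closedⱼ : Adjacency.BunchNeighboursInN₂ G x (nbr (suc zero))) where

  open Adjacency G
  open GirthAtLeast5 girth≥5
  open RegularGraph G regular
  open Bunches G regular girth≥5

  xᵢ xⱼ : Fin n
  xᵢ = nbr zero
  xⱼ = nbr (suc zero)

  xₒ : Fin (2 + k) → Fin n
  xₒ q = nbr (suc (suc q))

  hubs-non-adjacent : ∀ {i j} → ¬ Adj G (nbr i) (nbr j)
  hubs-non-adjacent {i} {j} ij = no-triangle (x-nbr i) ij (adj-sym (x-nbr j))

  parent-unique : ∀ {w i j} → w ≢ x → Adj G (nbr i) w → Adj G (nbr j) w → i ≡ j
  parent-unique w≢x iw jw =
    nbr-injective (common-neighbour-unique (w≢x ∘ sym) (x-nbr _) iw (x-nbr _) jw)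

  meets : ∀ {i y} → BunchNeighboursInN₂ x (nbr i) → InBunch G x (nbr i) y →
    ∀ j → j ≢ i → ∃ λ w → Adj G y w × InBunch G x (nbr j) w
  meets {i} closed y∈Xᵢ j j≢i =
    bunch-meets-bunch (x-nbr i) closed y∈Xᵢ (x-nbr j) (j≢i ∘ nbr-injective)

  closed-meets : ∀ {i j w} → BunchNeighboursInN₂ x (nbr i) → j ≢ i → InBunch G x (nbr j) w →
    ∃ λ b → InBunch G x (nbr i) b × Adj G w b
  closed-meets {i} {j} closed j≢i =
    closed-bunch-meets-bunch (x-nbr i) closed (x-nbr j) (j≢i ∘ nbr-injective)

  record Skeleton : Set where
    field
      u    : Fin n
      u∈Xᵢ : InBunch G x xᵢ u
      v    : Fin n
      uv   : Adj G u v
      v∈Xⱼ : InBunch G x xⱼ v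
      z    : Fin (2 + k) → Fin n
      uz   : ∀ q → Adj G u (z q)
      z∈Xₒ : ∀ q → InBunch G x (xₒ q) (z q)
      b    : Fin (2 + k) → Fin n
      zb   : ∀ q → Adj G (z q) (b q)
      b∈Xⱼ : ∀ q → InBunch G x xⱼ (b q)

  skeleton : Skeleton
  skeleton = record
    { u = u ; u∈Xᵢ = u∈Xᵢ
    ; v = proj₁ v-spec ; uv = proj₁ (proj₂ v-spec) ; v∈Xⱼ = proj₂ (proj₂ v-spec)
    ; z = proj₁ ∘ z-spec ; uz = proj₁ ∘ proj₂ ∘ z-spec ; z∈Xₒ = proj₂ ∘ proj₂ ∘ z-spec
    ; b = proj₁ ∘ b-spec ; zb = proj₂ ∘ proj₂ ∘ b-spec ; b∈Xⱼ = proj₁ ∘ proj₂ ∘ b-spec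
    }
    where
      u : Fin n
      u = proj₁ (bunch-nonempty G regular x xᵢ)
      u∈Xᵢ : InBunch G x xᵢ u
      u∈Xᵢ = proj₂ (bunch-nonempty G regular x xᵢ)
      v-spec : ∃ λ v → Adj G u v × InBunch G x xⱼ v
      v-spec = meets closedᵢ u∈Xᵢ (suc zero) (λ ())
      z-spec : ∀ q → ∃ λ z → Adj G u z × InBunch G x (xₒ q) z
      z-spec q = meets closedᵢ u∈Xᵢ (suc (suc q)) (λ ())
      b-spec : ∀ q → ∃ λ b → InBunch G x xⱼ b × Adj G (proj₁ (z-spec q)) b
      b-spec q = closed-meets closedⱼ (λ ()) (proj₂ (proj₂ (z-spec q)))

  module Colouring (S : Skeleton) where
    open Skeleton S

    Colour : Set
    Colour = Fin (5 + k)

    c₀ c₁ c₂ : Colour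
    c₀ = zero
    c₁ = suc zero
    c₂ = suc (suc zero)

    c₃₊ : Fin (2 + k) → Colour
    c₃₊ q = suc (suc (suc q))

    -- The shift keeps x_q off colour 3+q, which its children outside N(u) receive.
    hub-colour : Fin (4 + k) → Colour
    hub-colour zero = c₁
    hub-colour (suc zero) = c₀
    hub-colour (suc (suc q)) = c₃₊ (rotate q)

    data ChildOfXⱼ (w : Fin n) : Colour → Set where
      is-v   : w ≡ v → ChildOfXⱼ w c₁
      near-z : ∀ q → Adj G (z q) w → ChildOfXⱼ w (c₃₊ q)

    data ChildOfXₒ (q : Fin (2 + k)) (w : Fin n) : Colour → Set where
      near-u     : Adj G u w → ChildOfXₒ q w c₁
      far-from-u : ¬ Adj G u w → ChildOfXₒ q w (c₃₊ q)

    Child : Fin (4 + k) → Fin n → Colour → Set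
    Child zero _ c = c ≡ c₂
    Child (suc zero) = ChildOfXⱼ
    Child (suc (suc q)) = ChildOfXₒ q

    data Class (w : Fin n) : Colour → Set where
      centre : w ≡ x → Class w c₂
      hub    : ∀ i {c} → w ≡ nbr i → hub-colour i ≡ c → Class w c
      child  : ∀ i {c} → Adj G (nbr i) w → w ≢ x → Child i w c → Class w c

    u-not-in-Xⱼ : ¬ Adj G xⱼ u
    u-not-in-Xⱼ xⱼu = 0≢1+n (parent-unique (proj₂ u∈Xᵢ) (proj₁ u∈Xᵢ) xⱼu)

    z-injective : Injective _≡_ _≡_ z
    z-injective {q} {q'} eq = suc-injective (suc-injective (parent-unique (proj₂ (z∈Xₒ q))
      (proj₁ (z∈Xₒ q)) (subst (Adj G (xₒ q')) (sym eq) (proj₁ (z∈Xₒ q')))))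

    v-not-near-z : ∀ {q} → ¬ Adj G (z q) v
    v-not-near-z {q} zv = no-triangle uv (adj-sym zv) (adj-sym (uz q))

    child-unique : ∀ {i w c c'} → Adj G (nbr i) w → Child i w c → Child i w c' → c ≡ c'
    child-unique {zero} _ refl refl = refl
    child-unique {suc zero} _ (is-v _) (is-v _) = refl
    child-unique {suc zero} _ (is-v refl) (near-z q zv) = ⊥-elim (v-not-near-z zv)
    child-unique {suc zero} _ (near-z q zv) (is-v refl) = ⊥-elim (v-not-near-z zv)
    child-unique {suc zero} {w} xⱼw (near-z q zw) (near-z q' z'w) =
      cong c₃₊ (z-injective (common-neighbour-unique u≢w (uz q) zw (uz q') z'w))
      where
        u≢w : u ≢ w
        u≢w u≡w = u-not-in-Xⱼ (subst (Adj G xⱼ) (sym u≡w) xⱼw)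
    child-unique {suc (suc q)} _ (near-u _) (near-u _) = refl
    child-unique {suc (suc q)} _ (near-u uw) (far-from-u ¬uw) = ⊥-elim (¬uw uw)
    child-unique {suc (suc q)} _ (far-from-u ¬uw) (near-u uw) = ⊥-elim (¬uw uw)
    child-unique {suc (suc q)} _ (far-from-u _) (far-from-u _) = refl

    class-unique : ∀ {w c c'} → Class w c → Class w c' → c ≡ c'
    class-unique (centre _) (centre _) = refl
    class-unique (centre refl) (hub i x≡i _) = ⊥-elim (adj⇒≢ (x-nbr i) x≡i)
    class-unique (centre w≡x) (child _ _ w≢x _) = ⊥-elim (w≢x w≡x)
    class-unique (hub i x≡i _) (centre refl) = ⊥-elim (adj⇒≢ (x-nbr i) x≡i)
    class-unique (hub i w≡i h) (hub j w≡j h') =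
      trans (sym h) (trans (cong hub-colour (nbr-injective (trans (sym w≡i) w≡j))) h')
    class-unique (hub _ refl _) (child _ ji _ _) = ⊥-elim (hubs-non-adjacent ji)
    class-unique (child _ _ w≢x _) (centre w≡x) = ⊥-elim (w≢x w≡x)
    class-unique (child _ ji _ _) (hub _ refl _) = ⊥-elim (hubs-non-adjacent ji)
    class-unique (child i iw w≢x ch) (child j jw _ ch') with parent-unique w≢x iw jw
    ... | refl = child-unique iw ch ch'

    hub-colour≢c₂ : ∀ i → hub-colour i ≢ c₂
    hub-colour≢c₂ zero = λ ()
    hub-colour≢c₂ (suc zero) = λ ()
    hub-colour≢c₂ (suc (suc q)) = λ ()

    child-colour≢hub-colour : ∀ {i w c} → Child i w c → hub-colour i ≢ c
    child-colour≢hub-colour {zero} refl = λ ()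
    child-colour≢hub-colour {suc zero} (is-v _) = λ ()
    child-colour≢hub-colour {suc zero} (near-z _ _) = λ ()
    child-colour≢hub-colour {suc (suc q)} (near-u _) = λ ()
    child-colour≢hub-colour {suc (suc q)} (far-from-u _) =
      rotate-fixpoint-free q ∘ suc-injective ∘ suc-injective ∘ suc-injective

    hub-child-clash : ∀ {i j w c} → Adj G (nbr i) w → hub-colour i ≡ c →
      Adj G (nbr j) w → w ≢ x → Child j w c → ⊥
    hub-child-clash iw h jw w≢x ch with parent-unique w≢x iw jw
    ... | refl = child-colour≢hub-colour ch h

    far-child-not-near-z : ∀ {q w w'} → Adj G xⱼ w → Adj G (z q) w →
      Adj G (xₒ q) w' → ¬ Adj G u w' → ¬ Adj G w w'
    far-child-not-near-z {q} {w} {w'} xⱼw zw ow' ¬uw' ww' = ¬uw' (subst (Adj G u) z≡w' (uz q))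
      where
        o≢w : xₒ q ≢ w
        o≢w o≡w = hubs-non-adjacent (subst (Adj G xⱼ) (sym o≡w) xⱼw)
        z≡w' : z q ≡ w'
        z≡w' = common-neighbour-unique o≢w (proj₁ (z∈Xₒ q)) zw ow' (adj-sym ww')

    children-clash : ∀ {i j w w' c} → Adj G w w' → Adj G (nbr i) w → Child i w c →
      Adj G (nbr j) w' → Child j w' c → ⊥
    children-clash {zero} {zero} ww' iw refl jw' refl = no-triangle iw ww' (adj-sym jw')
    children-clash {zero} {suc zero} _ _ refl _ ()
    children-clash {zero} {suc (suc _)} _ _ refl _ ()
    children-clash {suc zero} {suc zero} ww' _ (is-v refl) _ (is-v refl) = adj-irrefl ww'
    children-clash {suc zero} {suc zero} ww' iw (near-z _ _) jw' (near-z _ _) =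
      no-triangle iw ww' (adj-sym jw')
    children-clash {suc zero} {suc (suc _)} ww' _ (is-v refl) _ (near-u uw') =
      no-triangle uv ww' (adj-sym uw')
    children-clash {suc (suc _)} {suc zero} ww' _ (near-u uw) _ (is-v refl) =
      no-triangle uw ww' (adj-sym uv)
    children-clash {suc zero} {suc (suc _)} ww' xⱼw (near-z _ zw) ow' (far-from-u ¬uw') =
      far-child-not-near-z xⱼw zw ow' ¬uw' ww'
    children-clash {suc (suc _)} {suc zero} ww' ow (far-from-u ¬uw) xⱼw' (near-z _ zw') =
      far-child-not-near-z xⱼw' zw' ow ¬uw (adj-sym ww')
    children-clash {suc (suc _)} {suc (suc _)} ww' _ (near-u uw) _ (near-u uw') =
      no-triangle uw ww' (adj-sym uw')
    children-clash {suc (suc _)} {suc (suc _)} ww' iw (far-from-u _) jw' (far-from-u _) =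
      no-triangle iw ww' (adj-sym jw')

    class-proper : ∀ {w w' c} → Adj G w w' → Class w c → Class w' c → ⊥
    class-proper ww' (centre refl) (centre refl) = adj-irrefl ww'
    class-proper _ (centre _) (hub i _ h) = hub-colour≢c₂ i h
    class-proper _ (hub i _ h) (centre _) = hub-colour≢c₂ i h
    class-proper ww' (centre refl) (child i iw' _ _) = no-triangle (x-nbr i) iw' (adj-sym ww')
    class-proper ww' (child i iw _ _) (centre refl) = no-triangle (x-nbr i) iw ww'
    class-proper ww' (hub _ refl _) (hub _ refl _) = hubs-non-adjacent ww'
    class-proper ww' (hub _ refl h) (child _ jw' w'≢x ch) = hub-child-clash ww' h jw' w'≢x ch
    class-proper ww' (child _ jw w≢x ch) (hub _ refl h) = hub-child-clash (adj-sym ww') h jw w≢x ch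
    class-proper ww' (child _ iw _ ch) (child _ jw' _ ch') = children-clash ww' iw ch jw' ch'

    child? : ∀ i w → Dec (∃ (Child i w))
    child? zero w = yes (c₂ , refl)
    child? (suc zero) w with w ≟ v | any? (λ q → Adj? (z q) w)
    ... | yes w≡v | _ = yes (c₁ , is-v w≡v)
    ... | no _ | yes (q , zw) = yes (c₃₊ q , near-z q zw)
    ... | no w≢v | no ¬zw = no λ { (_ , is-v w≡v) → w≢v w≡v ; (_ , near-z q zw) → ¬zw (q , zw) }
    child? (suc (suc q)) w with Adj? u w
    ... | yes uw = yes (c₁ , near-u uw)
    ... | no ¬uw = yes (c₃₊ q , far-from-u ¬uw)

    unclassified : ∀ {w} → w ≢ x → (∀ i → w ≢ nbr i) →
      (∀ i → Adj G (nbr i) w → ¬ ∃ (Child i w)) → ¬ ∃ (Class w)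
    unclassified w≢x _ _ (_ , centre w≡x) = w≢x w≡x
    unclassified _ not-hub _ (_ , hub i w≡i _) = not-hub i w≡i
    unclassified _ _ childless (_ , child i iw _ ch) = childless i iw (_ , ch)

    class? : ∀ w → Dec (∃ (Class w))
    class? w with w ≟ x
    ... | yes w≡x = yes (c₂ , centre w≡x)
    ... | no w≢x with any? (λ i → w ≟ nbr i)
    ...   | yes (i , w≡i) = yes (hub-colour i , hub i w≡i refl)
    ...   | no not-hub with any? (λ i → Adj? (nbr i) w)
    ...     | no orphan =
      no (unclassified w≢x (λ i w≡i → not-hub (i , w≡i)) (λ i iw _ → orphan (i , iw)))
    ...     | yes (i , iw) with child? i w
    ...       | yes (c , ch) = yes (c , child i iw w≢x ch)
    ...       | no ¬ch = no (unclassified w≢x (λ j w≡j → not-hub (j , w≡j)) λ j jw →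
      subst (λ j → ¬ ∃ (Child j w)) (parent-unique w≢x iw jw) ¬ch)

    precolour : Fin n → Maybe Colour
    precolour w with class? w
    ... | yes (c , _) = just c
    ... | no _ = nothing

    precolour⇒class : ∀ {w c} → precolour w ≡ just c → Class w c
    precolour⇒class {w} e with class? w
    ... | yes (_ , cl) with refl ← e = cl

    class⇒precolour : ∀ {w c} → Class w c → precolour w ≡ just c
    class⇒precolour {w} cl with class? w
    ... | yes (_ , cl') = cong just (class-unique cl' cl)
    ... | no unclassified = ⊥-elim (unclassified (_ , cl))

    precolour-proper : ProperPartial precolour
    precolour-proper ww' e e' = class-proper ww' (precolour⇒class e) (precolour⇒class e')

    far-from-u-near-b : ∀ {q q' y} → q' ≢ q → InBunch G x (xₒ q') y → Adj G (b q) y →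
      ¬ Adj G u y
    far-from-u-near-b {q} {q'} {y} q'≢q (q'y , _) by uy = q'≢q (suc-injective (suc-injective
      (parent-unique (proj₂ (z∈Xₒ q)) (subst (Adj G (xₒ q')) y≡z q'y) (proj₁ (z∈Xₒ q)))))
      where
        u≢b : u ≢ b q
        u≢b u≡b = u-not-in-Xⱼ (subst (Adj G xⱼ) (sym u≡b) (proj₁ (b∈Xⱼ q)))
        y≡z : y ≡ z q
        y≡z = common-neighbour-unique u≢b uy (adj-sym by) (uz q) (zb q)

    BVertex : Colour → Fin n → Set
    BVertex c β = Class β c × (∀ c' → ∃ λ w → w ∈N[ β ] × Class w c')

    xⱼ-class : Class xⱼ c₀
    xⱼ-class = hub (suc zero) refl refl

    v-class : Class v c₁
    v-class = child (suc zero) (proj₁ v∈Xⱼ) (proj₂ v∈Xⱼ) (is-v refl)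

    b-class : ∀ q → Class (b q) (c₃₊ q)
    b-class q = child (suc zero) (proj₁ (b∈Xⱼ q)) (proj₂ (b∈Xⱼ q)) (near-z q (zb q))

    Xᵢ-class : ∀ {w} → InBunch G x xᵢ w → Class w c₂
    Xᵢ-class (xᵢw , w≢x) = child zero xᵢw w≢x refl

    far-class : ∀ {q w} → InBunch G x (xₒ q) w → ¬ Adj G u w → Class w (c₃₊ q)
    far-class (ow , w≢x) ¬uw = child _ ow w≢x (far-from-u ¬uw)

    xⱼ-b-vertex : BVertex c₀ xⱼ
    xⱼ-b-vertex = xⱼ-class , λ where
      zero → xⱼ , inj₁ refl , xⱼ-class
      (suc zero) → v , inj₂ (proj₁ v∈Xⱼ) , v-class
      (suc (suc zero)) → x , inj₂ (adj-sym (x-nbr _)) , centre refl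
      (suc (suc (suc q))) → b q , inj₂ (proj₁ (b∈Xⱼ q)) , b-class q

    v-b-vertex : BVertex c₁ v
    v-b-vertex = v-class , λ where
      zero → xⱼ , inj₂ (adj-sym (proj₁ v∈Xⱼ)) , xⱼ-class
      (suc zero) → v , inj₁ refl , v-class
      (suc (suc zero)) → u , inj₂ (adj-sym uv) , Xᵢ-class u∈Xᵢ
      (suc (suc (suc q))) →
        let (y , vy , y∈Xₒ) = meets closedⱼ v∈Xⱼ (suc (suc q)) (λ ())
        in y , inj₂ vy , far-class y∈Xₒ (λ uy → no-triangle uv vy (adj-sym uy))

    x-b-vertex : BVertex c₂ x
    x-b-vertex = centre refl , λ where
      zero → xⱼ , inj₂ (x-nbr _) , xⱼ-class
      (suc zero) → xᵢ , inj₂ (x-nbr _) , hub zero refl refl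
      (suc (suc zero)) → x , inj₁ refl , centre refl
      (suc (suc (suc q))) →
        let (p , p↦q) = rotate-surjective q
        in xₒ p , inj₂ (x-nbr _) , hub (suc (suc p)) refl (cong c₃₊ p↦q)

    Xₒ-near-b : ∀ q q' → ∃ λ w → w ∈N[ b q ] × Class w (c₃₊ q')
    Xₒ-near-b q q' with q' ≟ q
    ... | yes refl = b q , inj₁ refl , b-class q
    ... | no q'≢q =
      let (y , by , y∈Xₒ) = meets closedⱼ (b∈Xⱼ q) (suc (suc q')) (λ ())
      in y , inj₂ by , far-class y∈Xₒ (far-from-u-near-b q'≢q y∈Xₒ by)

    b-b-vertex : ∀ q → BVertex (c₃₊ q) (b q)
    b-b-vertex q = b-class q , λ where
      zero → xⱼ , inj₂ (adj-sym (proj₁ (b∈Xⱼ q))) , xⱼ-class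
      (suc zero) →
        z q , inj₂ (adj-sym (zb q)) , child _ (proj₁ (z∈Xₒ q)) (proj₂ (z∈Xₒ q)) (near-u (uz q))
      (suc (suc zero)) →
        let (a , ba , a∈Xᵢ) = meets closedⱼ (b∈Xⱼ q) zero (λ ()) in a , inj₂ ba , Xᵢ-class a∈Xᵢ
      (suc (suc (suc q'))) → Xₒ-near-b q q'

    b-vertex : ∀ c → ∃ (BVertex c)
    b-vertex zero = xⱼ , xⱼ-b-vertex
    b-vertex (suc zero) = v , v-b-vertex
    b-vertex (suc (suc zero)) = x , x-b-vertex
    b-vertex (suc (suc (suc q))) = b q , b-b-vertex q

    b-colouring : HasBColoring G (5 + k)
    b-colouring with greedy-extension precolour precolour-proper
    ... | colouring , proper , extends = colouring , proper , λ c →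
      let (β , β-class , sees) = b-vertex c
      in β , coloured β-class , λ c' →
        let (w , w∈N[β] , w-class) = sees c' in w , w∈N[β] , coloured w-class
      where
        coloured : ∀ {w c} → Class w c → colouring w ≡ c
        coloured cl = extends (class⇒precolour cl)

  b-chromatic : BChromatic G (5 + k)
  b-chromatic = Colouring.b-colouring skeleton , b-colouring-bound

theorem9 : (d n : ℕ) (G : Graph n) → 7 ≤ d → Regular G d → Girth G 5 →
    (x xi xj : Fin n) → Adj G x xi → Adj G x xj → xi ≢ xj →
    (∀ t → (t ≡ xi ⊎ t ≡ xj) → ∀ y → InBunch G x t y →
       ∀ z → Adj G y z → InN₂ G x z) →
    BChromatic G (suc d)
theorem9 _ n G (s≤s (s≤s (s≤s (s≤s {n = k} _)))) regular girth x xi xj x-xi x-xj xi≢xj closed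
  with relabel (Adjacency.neighbours G regular x) x-xi x-xj xi≢xj
... | nbr , nbr-injective , x-nbr , refl , refl =
  Construction.b-chromatic G regular (proj₂ girth) x nbr nbr-injective x-nbr
    (closed _ (inj₁ refl)) (closed _ (inj₂ refl))
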